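{- There is an absolute constant $\kappa>0$ such that the following holds. Let $G=(V,E)$ be a graph with $m$ edges whose shortest cycle has length $\lambda\geq \kappa\log(m)$. Let $\widetilde{G}=(V,\widetilde{E})$ be obtained by subsampling the edges of $G$ according to any $(1/m^{200})$-almost $2\kappa\log(m)$-wise independent distribution with marginals $1/2$. Then $\widetilde{G}$ is cycle-free with probability at least $1-1/\mathrm{poly}(m)$.
   Context: $\log$ denotes the base-2 logarithm. A distribution on $X=(x_1,\dots,x_n)\in\{0,1\}^n$ is $\delta$-almost $k$-wise independent with marginals $p$ if for every $S\subseteq[n]$ with $|S|\leq k$, the total variation distance between the distribution of $X(S)$ and the distribution of $|S|$ independent Bernoulli$(p)$ bits is at most $\delta$. The subsample keeps edge $e$ iff $x_e=1$. "With probability at least $1-1/\mathrm{poly}(m)$" means with probability at least $1-m^{ -c}$ for some absolute constant $c>0$ (for all sufficiently large $m$).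
   Formalization: The almost independent distribution with marginals 1/2 used for subsampling has rational point masses, and the absolute constants κ and c are taken in the positive rationals. -}

module Defs where

open import Data.Nat as ℕ using (ℕ; zero; suc)
open import Data.Bool using (Bool; true; false; _∧_; if_then_else_)
open import Data.Bool.Base using (T)
open import Data.Fin using (Fin; inject₁; fromℕ)
open import Data.Fin.Base using () renaming (zero to fzero; suc to fsuc)
open import Data.Vec using (Vec; []; _∷_; lookup)
open import Data.List using (List; []; _∷_; map; _++_; filter)
open import Data.Product using (Σ; _×_; _,_; ∃)
open import Data.Sum using (_⊎_)
open import Data.Integer using (+_)
open import Data.Rational using (ℚ; 0ℚ; 1ℚ; _+_; _*_; _-_; ∣_∣; ½; _/_; _≤_)
open import Relation.Binary.PropositionalEquality using (_≡_)
open import Relation.Nullary using (¬_)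
open import Function.Definitions using (Injective)

ℕ→ℚ : ℕ → ℚ
ℕ→ℚ n = (+ n) / 1

_^ℚ_ : ℚ → ℕ → ℚ
q ^ℚ zero = 1ℚ
q ^ℚ suc k = q * (q ^ℚ k)

sumℚ : List ℚ → ℚ
sumℚ [] = 0ℚ
sumℚ (x ∷ xs) = x + sumℚ xs

allVecs : (m : ℕ) → List (Vec Bool m)
allVecs zero = [] ∷ []
allVecs (suc m) = map (false ∷_) (allVecs m) ++ map (true ∷_) (allVecs m)

record Distribution (m : ℕ) : Set where
  field
    mass     : Vec Bool m → ℚ
    nonneg   : ∀ x → 0ℚ ≤ mass x
    total    : sumℚ (map mass (allVecs m)) ≡ 1ℚ
open Distribution public

Pr : ∀ {m} → Distribution m → (Vec Bool m → Bool) → ℚ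
Pr {m} D A = sumℚ (map (λ x → if A x then mass D x else 0ℚ) (allVecs m))

-- Subsets S ⊆ [m] as characteristic vectors; restriction X(S)

card : ∀ {m} → Vec Bool m → ℕ
card [] = 0
card (true ∷ s) = suc (card s)
card (false ∷ s) = card s

agreeOn : ∀ {m} → Vec Bool m → Vec Bool m → Vec Bool m → Bool
agreeOn [] [] [] = true
agreeOn (true ∷ s) (a ∷ x) (b ∷ y) = eqB a b ∧ agreeOn s x y
  where
  eqB : Bool → Bool → Bool
  eqB true true = true
  eqB false false = true
  eqB _ _ = false
agreeOn (false ∷ s) (_ ∷ x) (_ ∷ y) = agreeOn s x y

-- y vanishes outside S (canonical representatives of patterns in {0,1}^S)
zeroOutside : ∀ {m} → Vec Bool m → Vec Bool m → Bool
zeroOutside [] [] = true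
zeroOutside (true ∷ s) (_ ∷ y) = zeroOutside s y
zeroOutside (false ∷ s) (false ∷ y) = zeroOutside s y
zeroOutside (false ∷ s) (true ∷ y) = false

patterns : ∀ {m} → Vec Bool m → List (Vec Bool m)
patterns {m} S = filter (λ y → T? (zeroOutside S y)) (allVecs m)
  where
  open import Relation.Nullary.Decidable using (Dec; yes; no)
  T? : (b : Bool) → Dec (T b)
  T? true = yes _
  T? false = no (λ ())

-- total variation distance between the law of X(S) under D and
-- |S| independent Bernoulli(1/2) bits:
--   (1/2) Σ_{y ∈ {0,1}^S} | Pr[X(S) = y] - (1/2)^{|S|} |
tvMarginalUniform : ∀ {m} → Distribution m → Vec Bool m → ℚ
tvMarginalUniform D S =
  ½ * sumℚ (map (λ y → ∣ Pr D (λ x → agreeOn S x y) - (½ ^ℚ card S) ∣) (patterns S))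

-- δ-almost k-wise independent with marginals 1/2, where the admissible
-- subset sizes are given by a predicate (|S| ≤ k) and δ by a predicate
AlmostIndependent : ∀ {m} → Distribution m → (sizeOK : ℕ → Set) → (δOK : ℚ → Set) → Set
AlmostIndependent {m} D sizeOK δOK =
  ∀ (S : Vec Bool m) → sizeOK (card S) → δOK (tvMarginalUniform D S)

Graph : ℕ → ℕ → Set
Graph n m = Vec (Fin n × Fin n) m

Joins : ∀ {n m} → Graph n m → Fin m → Fin n → Fin n → Set
Joins E e u v with lookup E e
... | (a , b) = (a ≡ u × b ≡ v) ⊎ (a ≡ v × b ≡ u)

record Cycle {n m : ℕ} (E : Graph n m) (keep : Vec Bool m) (ℓ : ℕ) : Set where
  field
    pos       : 1 ℕ.≤ ℓ
    vert      : Fin (suc ℓ) → Fin n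
    edge      : Fin ℓ → Fin m
    closed    : vert (fromℕ ℓ) ≡ vert fzero
    vdistinct : Injective _≡_ _≡_ (λ i → vert (inject₁ i))
    edistinct : Injective _≡_ _≡_ edge
    joins     : ∀ i → Joins E (edge i) (vert (inject₁ i)) (vert (fsuc i))
    kept      : ∀ i → lookup keep (edge i) ≡ true
open Cycle public

allTrue : (m : ℕ) → Vec Bool m
allTrue zero = []
allTrue (suc m) = true ∷ allTrue m

CycleFree : ∀ {n m} → Graph n m → Vec Bool m → Set
CycleFree E x = ∀ ℓ → ¬ Cycle E x ℓ

{-# OPTIONS --safe #-}
module Submission where

-- We take κ = 7 and c = 1, and a trail length L with 8m³ ≤ 2^L < 16m³, so that the girth
-- assumption rules out cycles of length ≤ 2L. Then two trails (walks with distinct edges) of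
-- length L with the same endpoints coincide: going out along one of them up to the last step
-- where their edges differ and back along the other is a closed non-backtracking walk of length
-- ≤ 2L, and such a walk contains a cycle. A cycle of the subsample has length ≥ L, hence contains
-- a fully kept trail of length L whose endpoints are endpoints of edges. So a cycle survives only
-- if, for one of the (2m)² pairs of such endpoints, all L edges of the unique trail between them
-- are kept. By almost L-wise independence this has probability ≤ 2^-L + 2m^-200 ≤ 1/(4m³), and
-- the union bound over the pairs gives failure probability ≤ 1/m.

open import Defs
open import Data.Nat as ℕ
  using (ℕ; zero; suc; _+_; _*_; _^_; _∸_; _≤_; _<_; z≤n; s≤s; z<s; _≤?_; _<?_; NonZero)
open import Data.Nat.Properties
open import Data.Nat.DivMod using (_mod_; m<n⇒m%n≡m)
open import Data.Nat.Tactic.RingSolver using (solve-∀)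
import Data.Nat.Coprimality as Coprime
import Data.Integer as ℤ
import Data.Integer.Properties as ℤ
open import Data.Rational as ℚ using (ℚ; 0ℚ; 1ℚ; ½; mkℚ; ∣_∣; -_; _-_; _/_)
  renaming (_+_ to _+ℚ_; _*_ to _*ℚ_; _≤_ to _≤ℚ_)
import Data.Rational.Properties as ℚ
open import Data.Rational.Solver using (module +-*-Solver)
open import Data.Bool using (Bool; true; false; not; _∨_; if_then_else_; T)
open import Data.Bool.Properties using (T-not-≡)
open import Data.Bool.ListAction using (any)
open import Data.Fin as Fin using (Fin; toℕ; inject₁)
open import Data.Fin.Properties using (toℕ-injective; toℕ-fromℕ<; toℕ-fromℕ; toℕ-inject₁; toℕ<n; any?)
  renaming (_≟_ to _≟ᶠ_)
open import Data.Vec using (Vec; []; _∷_; lookup; replicate; tabulate; _[_]≔_)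
open import Data.Vec.Properties using (lookup∘update′; lookup-replicate; lookup∘tabulate)
open import Data.List using (List; []; _∷_; map; _++_; length; allFin; cartesianProduct)
open import Data.List.Properties using (map-cong; length-++; length-map; length-tabulate)
open import Data.List.Membership.Propositional using (_∈_; lose)
open import Data.List.Membership.Propositional.Properties
  using (∈-map⁺; ∈-++⁺ˡ; ∈-++⁺ʳ; ∈-filter⁺; ∈-allFin; ∈-cartesianProduct⁺)
open import Data.List.Relation.Unary.Any using (here; there)
open import Data.List.Relation.Unary.Any.Properties using (any⁺)
open import Data.Product using (Σ; ∃; _×_; _,_; proj₁; proj₂)
open import Data.Sum using (_⊎_; inj₁; inj₂; [_,_]′)
open import Data.Empty using (⊥-elim)
open import Function using (_∘_; id)
open import Function.Bundles using (Equivalence)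
open import Relation.Binary.Definitions using (tri<; tri≈; tri>)
open import Relation.Binary.PropositionalEquality
open import Relation.Nullary using (¬_; Dec; yes; no; contradiction)
open import Relation.Nullary.Decidable using (map′; _×-dec_; _⊎-dec_; _→-dec_)
open import Relation.Unary using (Decidable)

ℕ→ℚ≡mkℚ : ∀ n → ℕ→ℚ n ≡ mkℚ (ℤ.+ n) 0 (Coprime.sym (Coprime.1-coprimeTo n))
ℕ→ℚ≡mkℚ n = ℚ.↥p/↧p≡p (mkℚ (ℤ.+ n) 0 _)

ℕ→ℚ-homo-* : ∀ a b → ℕ→ℚ (a * b) ≡ ℕ→ℚ a *ℚ ℕ→ℚ b
ℕ→ℚ-homo-* a b =
  trans (cong (_/ 1) (ℤ.pos-* a b)) (sym (cong₂ _*ℚ_ (ℕ→ℚ≡mkℚ a) (ℕ→ℚ≡mkℚ b)))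

ℕ→ℚ-homo-+ : ∀ a b → ℕ→ℚ (a + b) ≡ ℕ→ℚ a +ℚ ℕ→ℚ b
ℕ→ℚ-homo-+ a b =
  trans (cong (_/ 1) (trans (ℤ.pos-+ a b) (sym (cong₂ ℤ._+_ (ℤ.*-identityʳ (ℤ.+ a))
                                                            (ℤ.*-identityʳ (ℤ.+ b))))))
        (sym (cong₂ _+ℚ_ (ℕ→ℚ≡mkℚ a) (ℕ→ℚ≡mkℚ b)))

ℕ→ℚ-mono-≤ : ∀ {a b} → a ≤ b → ℕ→ℚ a ≤ℚ ℕ→ℚ b
ℕ→ℚ-mono-≤ {a} {b} a≤b rewrite ℕ→ℚ≡mkℚ a | ℕ→ℚ≡mkℚ b =
  ℚ.*≤* (ℤ.*-monoʳ-≤-nonNeg (ℤ.+ 1) (ℤ.+≤+ a≤b))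

ℕ→ℚ-nonNeg : ∀ n → ℚ.NonNegative (ℕ→ℚ n)
ℕ→ℚ-nonNeg n = ℚ.nonNegative (ℕ→ℚ-mono-≤ {0} {n} z≤n)

ℕ→ℚ-pos : ∀ {n} → 1 ≤ n → ℚ.Positive (ℕ→ℚ n)
ℕ→ℚ-pos {suc n} _ rewrite ℕ→ℚ≡mkℚ (suc n) = _

p≤∣p∣ : ∀ p → p ≤ℚ ∣ p ∣
p≤∣p∣ p with ℚ.∣p∣≡p∨∣p∣≡-p p
... | inj₁ ∣p∣≡p = ℚ.≤-reflexive (sym ∣p∣≡p)
... | inj₂ ∣p∣≡-p = begin
  p         ≡⟨ ℚ.+-identityʳ p ⟨
  p +ℚ 0ℚ   ≤⟨ ℚ.+-monoʳ-≤ p (subst (0ℚ ≤ℚ_) ∣p∣≡-p (ℚ.0≤∣p∣ p)) ⟩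
  p +ℚ - p  ≡⟨ ℚ.+-inverseʳ p ⟩
  0ℚ        ≤⟨ ℚ.0≤∣p∣ p ⟩
  ∣ p ∣     ∎
  where open ℚ.≤-Reasoning

≤+∣-∣ : ∀ p q → p ≤ℚ q +ℚ ∣ p - q ∣
≤+∣-∣ p q = begin
  p                ≡⟨ +-[-] p q ⟩
  q +ℚ (p - q)     ≤⟨ ℚ.+-monoʳ-≤ q (p≤∣p∣ (p - q)) ⟩
  q +ℚ ∣ p - q ∣   ∎
  where
  open ℚ.≤-Reasoning
  open +-*-Solver
  +-[-] : ∀ p q → p ≡ q +ℚ (p - q)
  +-[-] = solve 2 (λ p q → p := q :+ (p :- q)) refl

½^k≥0 : ∀ k → 0ℚ ≤ℚ ½ ^ℚ k
½^k≥0 zero    = ℚ.nonNegative⁻¹ 1ℚ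
½^k≥0 (suc k) = subst (_≤ℚ ½ *ℚ ½ ^ℚ k) (ℚ.*-zeroʳ ½) (ℚ.*-monoˡ-≤-nonNeg ½ (½^k≥0 k))

½^k*2^k≡1 : ∀ k → ½ ^ℚ k *ℚ ℕ→ℚ (2 ^ k) ≡ 1ℚ
½^k*2^k≡1 zero    = refl
½^k*2^k≡1 (suc k) = begin
  ½ *ℚ ½ ^ℚ k *ℚ ℕ→ℚ (2 * 2 ^ k)             ≡⟨ cong (½ *ℚ ½ ^ℚ k *ℚ_) (ℕ→ℚ-homo-* 2 (2 ^ k)) ⟩
  ½ *ℚ ½ ^ℚ k *ℚ (ℕ→ℚ 2 *ℚ ℕ→ℚ (2 ^ k))      ≡⟨ rearrange ½ (½ ^ℚ k) (ℕ→ℚ 2) (ℕ→ℚ (2 ^ k)) ⟩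
  (½ *ℚ ℕ→ℚ 2) *ℚ (½ ^ℚ k *ℚ ℕ→ℚ (2 ^ k))   ≡⟨ cong (1ℚ *ℚ_) (½^k*2^k≡1 k) ⟩
  1ℚ *ℚ 1ℚ                                   ∎
  where
  open ≡-Reasoning
  open +-*-Solver
  rearrange : ∀ a b c d → a *ℚ b *ℚ (c *ℚ d) ≡ (a *ℚ c) *ℚ (b *ℚ d)
  rearrange = solve 4 (λ a b c d → a :* b :* (c :* d) := (a :* c) :* (b :* d)) refl

module _ {A : Set} where

  sumℚ-+ : ∀ (g h : A → ℚ) xs →
           sumℚ (map (λ x → g x +ℚ h x) xs) ≡ sumℚ (map g xs) +ℚ sumℚ (map h xs)
  sumℚ-+ g h []       = refl
  sumℚ-+ g h (x ∷ xs) = trans (cong (g x +ℚ h x +ℚ_) (sumℚ-+ g h xs)) (interchange (g x) (h x) _ _)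
    where
    open +-*-Solver
    interchange : ∀ a b c d → (a +ℚ b) +ℚ (c +ℚ d) ≡ (a +ℚ c) +ℚ (b +ℚ d)
    interchange = solve 4 (λ a b c d → (a :+ b) :+ (c :+ d) := (a :+ c) :+ (b :+ d)) refl

  sumℚ-zero : ∀ (xs : List A) → sumℚ (map (λ _ → 0ℚ) xs) ≡ 0ℚ
  sumℚ-zero []       = refl
  sumℚ-zero (x ∷ xs) = trans (ℚ.+-identityˡ _) (sumℚ-zero xs)

  sumℚ-mono-≤ : ∀ {g h : A → ℚ} → (∀ x → g x ≤ℚ h x) → ∀ xs → sumℚ (map g xs) ≤ℚ sumℚ (map h xs)
  sumℚ-mono-≤ g≤h []       = ℚ.≤-refl
  sumℚ-mono-≤ g≤h (x ∷ xs) = ℚ.+-mono-≤ (g≤h x) (sumℚ-mono-≤ g≤h xs)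

  sumℚ-nonNeg : ∀ {g : A → ℚ} → (∀ x → 0ℚ ≤ℚ g x) → ∀ xs → 0ℚ ≤ℚ sumℚ (map g xs)
  sumℚ-nonNeg {g} g≥0 xs = subst (_≤ℚ sumℚ (map g xs)) (sumℚ-zero xs) (sumℚ-mono-≤ g≥0 xs)

  term≤sumℚ : ∀ {g : A → ℚ} → (∀ x → 0ℚ ≤ℚ g x) → ∀ {x xs} → x ∈ xs → g x ≤ℚ sumℚ (map g xs)
  term≤sumℚ {g} g≥0 {xs = y ∷ ys} (here refl) =
    subst (_≤ℚ sumℚ (map g (y ∷ ys))) (ℚ.+-identityʳ (g y)) (ℚ.+-monoʳ-≤ (g y) (sumℚ-nonNeg g≥0 ys))
  term≤sumℚ {g} g≥0 {xs = y ∷ ys} (there x∈ys) =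
    subst (_≤ℚ sumℚ (map g (y ∷ ys))) (ℚ.+-identityˡ _) (ℚ.+-mono-≤ (g≥0 y) (term≤sumℚ g≥0 x∈ys))

  sumℚ*≤length : ∀ {g : A → ℚ} {c} → (∀ x → g x *ℚ c ≤ℚ 1ℚ) → ∀ xs →
                 sumℚ (map g xs) *ℚ c ≤ℚ ℕ→ℚ (length xs)
  sumℚ*≤length {g} {c} gc≤1 []       = ℚ.≤-reflexive (ℚ.*-zeroˡ c)
  sumℚ*≤length {g} {c} gc≤1 (x ∷ xs) = begin
    (g x +ℚ sumℚ (map g xs)) *ℚ c         ≡⟨ ℚ.*-distribʳ-+ c (g x) _ ⟩
    g x *ℚ c +ℚ sumℚ (map g xs) *ℚ c      ≤⟨ ℚ.+-mono-≤ (gc≤1 x) (sumℚ*≤length gc≤1 xs) ⟩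
    1ℚ +ℚ ℕ→ℚ (length xs)                 ≡⟨ ℕ→ℚ-homo-+ 1 (length xs) ⟨
    ℕ→ℚ (suc (length xs))                 ∎
    where open ℚ.≤-Reasoning

-- Probabilities of events

allVecs-complete : ∀ {m} (v : Vec Bool m) → v ∈ allVecs m
allVecs-complete []          = here refl
allVecs-complete (false ∷ v) = ∈-++⁺ˡ (∈-map⁺ (false ∷_) (allVecs-complete v))
allVecs-complete {suc m} (true ∷ v) =
  ∈-++⁺ʳ (map (false ∷_) (allVecs m)) (∈-map⁺ (true ∷_) (allVecs-complete v))

zeroOutside-self : ∀ {m} (S : Vec Bool m) → T (zeroOutside S S)
zeroOutside-self []          = _
zeroOutside-self (true ∷ S)  = zeroOutside-self S
zeroOutside-self (false ∷ S) = zeroOutside-self S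

module _ {m} (D : Distribution m) where

  private
    weight : (Vec Bool m → Bool) → Vec Bool m → ℚ
    weight A x = if A x then mass D x else 0ℚ

  Pr-false : Pr D (λ _ → false) ≡ 0ℚ
  Pr-false = sumℚ-zero (allVecs m)

  Pr-∨ : ∀ A B → Pr D (λ x → A x ∨ B x) ≤ℚ Pr D A +ℚ Pr D B
  Pr-∨ A B = ℚ.≤-trans (sumℚ-mono-≤ split (allVecs m)) (ℚ.≤-reflexive (sumℚ-+ (weight A) (weight B) (allVecs m)))
    where
    split : ∀ x → (if A x ∨ B x then mass D x else 0ℚ) ≤ℚ
                  (if A x then mass D x else 0ℚ) +ℚ (if B x then mass D x else 0ℚ)
    split x with A x | B x
    ... | true  | true  = subst (_≤ℚ mass D x +ℚ mass D x) (ℚ.+-identityʳ (mass D x))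
                                (ℚ.+-monoʳ-≤ (mass D x) (nonneg D x))
    ... | true  | false = ℚ.≤-reflexive (sym (ℚ.+-identityʳ _))
    ... | false | true  = ℚ.≤-reflexive (sym (ℚ.+-identityˡ _))
    ... | false | false = ℚ.≤-reflexive (sym (ℚ.+-identityˡ _))

  Pr-any : ∀ {K : Set} (B : K → Vec Bool m → Bool) ks →
           Pr D (λ x → any (λ k → B k x) ks) ≤ℚ sumℚ (map (λ k → Pr D (B k)) ks)
  Pr-any B []       = ℚ.≤-reflexive Pr-false
  Pr-any B (k ∷ ks) = ℚ.≤-trans (Pr-∨ (B k) _) (ℚ.+-monoʳ-≤ (Pr D (B k)) (Pr-any B ks))

  Pr-not : ∀ A → 1ℚ - Pr D (λ x → not (A x)) ≡ Pr D A
  Pr-not A = begin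
    1ℚ - Pr D (not ∘ A)                        ≡⟨ cong (_- Pr D (not ∘ A)) (trans (sym (total D)) split) ⟩
    Pr D (not ∘ A) +ℚ Pr D A - Pr D (not ∘ A)  ≡⟨ cancel (Pr D (not ∘ A)) (Pr D A) ⟩
    Pr D A                                     ∎
    where
    open ≡-Reasoning
    open +-*-Solver
    cancel : ∀ a b → a +ℚ b - a ≡ b
    cancel = solve 2 (λ a b → a :+ b :- a := b) refl
    split : sumℚ (map (mass D) (allVecs m)) ≡ Pr D (not ∘ A) +ℚ Pr D A
    split = trans (cong sumℚ (map-cong pointwise (allVecs m))) (sumℚ-+ (weight (not ∘ A)) (weight A) (allVecs m))
      where
      pointwise : ∀ x → mass D x ≡ (if not (A x) then mass D x else 0ℚ) +ℚ (if A x then mass D x else 0ℚ)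
      pointwise x with A x
      ... | true  = sym (ℚ.+-identityˡ _)
      ... | false = sym (ℚ.+-identityʳ _)

  Pr-agreeOn-self≤ : ∀ S → Pr D (λ x → agreeOn S x S) ≤ℚ ½ ^ℚ card S +ℚ ℕ→ℚ 2 *ℚ tvMarginalUniform D S
  Pr-agreeOn-self≤ S = begin
    p                              ≤⟨ ≤+∣-∣ p c ⟩
    c +ℚ ∣ p - c ∣                 ≤⟨ ℚ.+-monoʳ-≤ c (term≤sumℚ (λ _ → ℚ.0≤∣p∣ _) S∈patterns) ⟩
    c +ℚ deviations                ≡⟨ cong (c +ℚ_) (double-half deviations) ⟨
    c +ℚ ℕ→ℚ 2 *ℚ (½ *ℚ deviations) ∎
    where
    open ℚ.≤-Reasoning
    p = Pr D (λ x → agreeOn S x S)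
    c = ½ ^ℚ card S
    deviations = sumℚ (map (λ y → ∣ Pr D (λ x → agreeOn S x y) - c ∣) (patterns S))
    -- S represents the all-ones pattern on S, so its deviation is one term of the TV sum.
    S∈patterns : S ∈ patterns S
    S∈patterns = ∈-filter⁺ _ (allVecs-complete S) (zeroOutside-self S)
    double-half : ∀ s → ℕ→ℚ 2 *ℚ (½ *ℚ s) ≡ s
    double-half s = trans (sym (ℚ.*-assoc (ℕ→ℚ 2) ½ s)) (ℚ.*-identityˡ s)

  union-bound : ∀ {K : Set} (B : K → Vec Bool m → Bool) ks c → 1 ≤ length ks →
                (∀ k → Pr D (B k) *ℚ ℕ→ℚ (length ks * c) ≤ℚ 1ℚ) →
                Pr D (λ x → any (λ k → B k x) ks) *ℚ ℕ→ℚ c ≤ℚ 1ℚ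
  union-bound B ks c 1≤#ks bound = ℚ.*-cancelʳ-≤-pos (ℕ→ℚ #ks) {{ℕ→ℚ-pos 1≤#ks}} (begin
    p∪ *ℚ ℕ→ℚ c *ℚ ℕ→ℚ #ks                              ≡⟨ regroup p∪ ⟩
    p∪ *ℚ ℕ→ℚ (#ks * c)                                 ≤⟨ ℚ.*-monoʳ-≤-nonNeg (ℕ→ℚ (#ks * c))
                                                             {{ℕ→ℚ-nonNeg (#ks * c)}} (Pr-any B ks) ⟩
    sumℚ (map (λ k → Pr D (B k)) ks) *ℚ ℕ→ℚ (#ks * c)   ≤⟨ sumℚ*≤length bound ks ⟩
    ℕ→ℚ #ks                                             ≡⟨ ℚ.*-identityˡ (ℕ→ℚ #ks) ⟨
    1ℚ *ℚ ℕ→ℚ #ks                                       ∎)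
    where
    open ℚ.≤-Reasoning
    #ks = length ks
    p∪ = Pr D (λ x → any (λ k → B k x) ks)
    regroup : ∀ p → p *ℚ ℕ→ℚ c *ℚ ℕ→ℚ #ks ≡ p *ℚ ℕ→ℚ (#ks * c)
    regroup p = begin-equality
      p *ℚ ℕ→ℚ c *ℚ ℕ→ℚ #ks     ≡⟨ ℚ.*-assoc p (ℕ→ℚ c) (ℕ→ℚ #ks) ⟩
      p *ℚ (ℕ→ℚ c *ℚ ℕ→ℚ #ks)   ≡⟨ cong (p *ℚ_) (ℚ.*-comm (ℕ→ℚ c) (ℕ→ℚ #ks)) ⟩
      p *ℚ (ℕ→ℚ #ks *ℚ ℕ→ℚ c)   ≡⟨ cong (p *ℚ_) (ℕ→ℚ-homo-* #ks c) ⟨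
      p *ℚ ℕ→ℚ (#ks * c)        ∎

  tvMarginalUniform-nonNeg : ∀ S → 0ℚ ≤ℚ tvMarginalUniform D S
  tvMarginalUniform-nonNeg S = begin
    0ℚ          ≡⟨ ℚ.*-zeroʳ ½ ⟨
    ½ *ℚ 0ℚ     ≤⟨ ℚ.*-monoˡ-≤-nonNeg ½ (sumℚ-nonNeg (λ _ → ℚ.0≤∣p∣ _) (patterns S)) ⟩
    tvMarginalUniform D S ∎
    where open ℚ.≤-Reasoning

X≤½^k+2t⇒X*Q≤1 : ∀ {X t : ℚ} {k Q P : ℕ} → 0ℚ ≤ℚ t → X ≤ℚ ½ ^ℚ k +ℚ ℕ→ℚ 2 *ℚ t →
                  2 * Q ≤ 2 ^ k → 4 * Q ≤ P → t *ℚ ℕ→ℚ P ≤ℚ 1ℚ → X *ℚ ℕ→ℚ Q ≤ℚ 1ℚ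
X≤½^k+2t⇒X*Q≤1 {X} {t} {k} {Q} {P} t≥0 X≤ 2Q≤2^k 4Q≤P tP≤1 = begin
  X *ℚ q                                          ≤⟨ ℚ.*-monoʳ-≤-nonNeg q {{ℕ→ℚ-nonNeg Q}} X≤ ⟩
  (½ ^ℚ k +ℚ two *ℚ t) *ℚ q                       ≡⟨ regroup ⟩
  ½ *ℚ (½ ^ℚ k *ℚ ℕ→ℚ (2 * Q) +ℚ t *ℚ ℕ→ℚ (4 * Q)) ≤⟨ ℚ.*-monoˡ-≤-nonNeg ½ (ℚ.+-mono-≤ first second) ⟩
  ½ *ℚ (1ℚ +ℚ 1ℚ)                                 ∎
  where
  open ℚ.≤-Reasoning
  q = ℕ→ℚ Q
  two = ℕ→ℚ 2
  first : ½ ^ℚ k *ℚ ℕ→ℚ (2 * Q) ≤ℚ 1ℚ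
  first = ℚ.≤-trans (ℚ.*-monoˡ-≤-nonNeg (½ ^ℚ k) {{ℚ.nonNegative (½^k≥0 k)}} (ℕ→ℚ-mono-≤ 2Q≤2^k))
                    (ℚ.≤-reflexive (½^k*2^k≡1 k))
  second : t *ℚ ℕ→ℚ (4 * Q) ≤ℚ 1ℚ
  second = ℚ.≤-trans (ℚ.*-monoˡ-≤-nonNeg t {{ℚ.nonNegative t≥0}} (ℕ→ℚ-mono-≤ 4Q≤P)) tP≤1
  ℕ→ℚ[2Q] : ℕ→ℚ (2 * Q) ≡ two *ℚ q
  ℕ→ℚ[2Q] = ℕ→ℚ-homo-* 2 Q
  ℕ→ℚ[4Q] : ℕ→ℚ (4 * Q) ≡ two *ℚ two *ℚ q
  ℕ→ℚ[4Q] = trans (ℕ→ℚ-homo-* 4 Q) (cong (_*ℚ q) (ℕ→ℚ-homo-* 2 2))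
  -- The closed term ½ *ℚ two computes to 1ℚ.
  regroup : (½ ^ℚ k +ℚ two *ℚ t) *ℚ q ≡ ½ *ℚ (½ ^ℚ k *ℚ ℕ→ℚ (2 * Q) +ℚ t *ℚ ℕ→ℚ (4 * Q))
  regroup = begin-equality
    (½ ^ℚ k +ℚ two *ℚ t) *ℚ q                             ≡⟨ ℚ.*-identityˡ _ ⟨
    (½ *ℚ two) *ℚ ((½ ^ℚ k +ℚ two *ℚ t) *ℚ q)             ≡⟨ ring ½ two (½ ^ℚ k) t q ⟩
    ½ *ℚ (½ ^ℚ k *ℚ (two *ℚ q) +ℚ t *ℚ (two *ℚ two *ℚ q)) ≡⟨ cong₂ (λ u v → ½ *ℚ (½ ^ℚ k *ℚ u +ℚ t *ℚ v))
                                                                   ℕ→ℚ[2Q] ℕ→ℚ[4Q] ⟨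
    ½ *ℚ (½ ^ℚ k *ℚ ℕ→ℚ (2 * Q) +ℚ t *ℚ ℕ→ℚ (4 * Q))     ∎
    where
    open +-*-Solver
    ring : ∀ h w a t q → (h *ℚ w) *ℚ ((a +ℚ w *ℚ t) *ℚ q) ≡ h *ℚ (a *ℚ (w *ℚ q) +ℚ t *ℚ (w *ℚ w *ℚ q))
    ring = solve 5 (λ h w a t q → (h :* w) :* ((a :+ w :* t) :* q)
                                  := h :* (a :* (w :* q) :+ t :* (w :* w :* q))) refl

-- Walks, trails and cycles

module _ {P : ℕ → Set} (P? : Decidable P) where

  least-witness : ∀ n → (∃ λ k → k ≤ n × P k) → ∃ λ j → j ≤ n × P j × (∀ {t} → t < j → ¬ P t)
  least-witness zero    (0 , z≤n , p0) = 0 , z≤n , p0 , λ ()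
  least-witness (suc n) (k , k≤1+n , pk) with anyUpTo? P? (suc n)
  ... | no none = k , k≤1+n , pk , λ t<k pt → none (_ , <-≤-trans t<k k≤1+n , pt)
  ... | yes (k′ , k′<1+n , pk′) with least-witness n (k′ , ≤-pred k′<1+n , pk′)
  ...   | j , j≤n , pj , below = j , m≤n⇒m≤1+n j≤n , pj , below

toℕ-mod : ∀ {t n} .{{_ : NonZero n}} → t < n → toℕ (t mod n) ≡ t
toℕ-mod t<n = trans (toℕ-fromℕ< _) (m<n⇒m%n≡m t<n)

lookup-allTrue : ∀ {m} (e : Fin m) → lookup (allTrue m) e ≡ true
lookup-allTrue Fin.zero    = refl
lookup-allTrue (Fin.suc e) = lookup-allTrue e

<-or-≥ : ∀ t k → t < k ⊎ k ≤ t
<-or-≥ t k with t <? k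
... | yes t<k = inj₁ t<k
... | no t≮k  = inj₂ (≮⇒≥ t≮k)

module _ {A : Set} (k : ℕ) where

  appendᵥ : (ℕ → A) → (ℕ → A) → ℕ → A
  appendᵥ u v t with t ≤? k
  ... | yes _ = u t
  ... | no _  = v (t ∸ k)

  appendᵥ-≤ : ∀ {u v t} → t ≤ k → appendᵥ u v t ≡ u t
  appendᵥ-≤ {t = t} t≤k with t ≤? k
  ... | yes _  = refl
  ... | no t≰k = contradiction t≤k t≰k

  appendᵥ-≥ : ∀ {u v t} → u k ≡ v 0 → k ≤ t → appendᵥ u v t ≡ v (t ∸ k)
  appendᵥ-≥ {u} {v} {t} uk≡v0 k≤t with t ≤? k
  ... | no _    = refl
  ... | yes t≤k rewrite ≤-antisym t≤k k≤t | n∸n≡0 k = uk≡v0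

  appendₑ : (ℕ → A) → (ℕ → A) → ℕ → A
  appendₑ f g t with t <? k
  ... | yes _ = f t
  ... | no _  = g (t ∸ k)

  appendₑ-< : ∀ {f g t} → t < k → appendₑ f g t ≡ f t
  appendₑ-< {t = t} t<k with t <? k
  ... | yes _  = refl
  ... | no t≮k = contradiction t<k t≮k

  appendₑ-≥ : ∀ {f g t} → k ≤ t → appendₑ f g t ≡ g (t ∸ k)
  appendₑ-≥ {t = t} k≤t with t <? k
  ... | yes t<k = contradiction k≤t (<⇒≱ t<k)
  ... | no _    = refl

module _ {n m : ℕ} (E : Graph n m) where

  joins-sym : ∀ {e u v} → Joins E e u v → Joins E e v u
  joins-sym (inj₁ (p , q)) = inj₂ (p , q)
  joins-sym (inj₂ (p , q)) = inj₁ (p , q)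

  joins-ends : ∀ {e u v u′ v′} → Joins E e u v → Joins E e u′ v′ →
               (u ≡ u′ × v ≡ v′) ⊎ (u ≡ v′ × v ≡ u′)
  joins-ends (inj₁ (refl , refl)) (inj₁ (refl , refl)) = inj₁ (refl , refl)
  joins-ends (inj₁ (refl , refl)) (inj₂ (refl , refl)) = inj₂ (refl , refl)
  joins-ends (inj₂ (refl , refl)) (inj₁ (refl , refl)) = inj₂ (refl , refl)
  joins-ends (inj₂ (refl , refl)) (inj₂ (refl , refl)) = inj₁ (refl , refl)

  joins-cong : ∀ {e e′ u u′ v v′} → e ≡ e′ → u ≡ u′ → v ≡ v′ → Joins E e u v → Joins E e′ u′ v′
  joins-cong refl refl refl j = j

  joins-other-end : ∀ {e u u′ v} → Joins E e u v → Joins E e u′ v → u ≡ u′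
  joins-other-end j j′ with joins-ends j j′
  ... | inj₁ (u≡u′ , _)     = u≡u′
  ... | inj₂ (u≡v , v≡u′)   = trans u≡v v≡u′

  Cycle-allTrue : ∀ {x ℓ} → Cycle E x ℓ → Cycle E (allTrue m) ℓ
  Cycle-allTrue c = record
    { pos = pos c ; vert = vert c ; edge = edge c ; closed = closed c ; vdistinct = vdistinct c
    ; edistinct = edistinct c ; joins = joins c ; kept = lookup-allTrue ∘ edge c }

  Walk : ℕ → (ℕ → Fin n) → (ℕ → Fin m) → Set
  Walk d w f = ∀ {t} → t < d → Joins E (f t) (w t) (w (suc t))

  NonBacktracking : ℕ → (ℕ → Fin m) → Set
  NonBacktracking d f = ∀ {t} → suc t < d → f t ≢ f (suc t)

  record Trail (d : ℕ) (w : ℕ → Fin n) (f : ℕ → Fin m) : Set where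
    field
      walk            : Walk d w f
      edges-injective : ∀ {s t} → s < d → t < d → f s ≡ f t → s ≡ t

    nonBacktracking : NonBacktracking d f
    nonBacktracking 1+t<d ft≡f1+t = 1+n≢n (sym (edges-injective (<-trans (n<1+n _) 1+t<d) 1+t<d ft≡f1+t))
  open Trail

  Walk-≤ : ∀ {d d′ w f} → d ≤ d′ → Walk d′ w f → Walk d w f
  Walk-≤ d≤d′ W t<d = W (<-≤-trans t<d d≤d′)

  NonBacktracking-≤ : ∀ {d d′ f} → d ≤ d′ → NonBacktracking d′ f → NonBacktracking d f
  NonBacktracking-≤ d≤d′ NB 1+t<d = NB (<-≤-trans 1+t<d d≤d′)

  Walk-drop : ∀ {d d′ w f} i → i + d ≤ d′ → Walk d′ w f → Walk d (λ t → w (i + t)) (λ t → f (i + t))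
  Walk-drop {w = w} i i+d≤d′ W {t} t<d =
    joins-cong refl refl (cong w (sym (+-suc i t))) (W (<-≤-trans (+-monoʳ-< i t<d) i+d≤d′))

  NonBacktracking-drop : ∀ {d d′ f} i → i + d ≤ d′ → NonBacktracking d′ f →
                         NonBacktracking d (λ t → f (i + t))
  NonBacktracking-drop {d′ = d′} {f} i i+d≤d′ NB {t} 1+t<d eq =
    NB (subst (_< d′) (+-suc i t) (<-≤-trans (+-monoʳ-< i 1+t<d) i+d≤d′)) (trans eq (cong f (+-suc i t)))

  simple-closed-walk⇒cycle : ∀ {d w f} → 1 ≤ d → Walk d w f → NonBacktracking d f → w d ≡ w 0 →
                             (∀ {s t} → s < d → t < d → w s ≡ w t → s ≡ t) → Cycle E (allTrue m) d
  simple-closed-walk⇒cycle {d} {w} {f} 1≤d W NB wd≡w0 w-inj = record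
    { pos       = 1≤d
    ; vert      = w ∘ toℕ
    ; edge      = f ∘ toℕ
    ; closed    = trans (cong w (toℕ-fromℕ d)) wd≡w0
    ; vdistinct = λ {i} {j} eq → toℕ-injective (inject₁-inj i j eq)
    ; edistinct = λ {i} {j} eq → toℕ-injective (f-inj (toℕ<n i) (toℕ<n j) eq)
    ; joins     = λ i → joins-cong refl (cong w (sym (toℕ-inject₁ i))) refl (W (toℕ<n i))
    ; kept      = λ i → lookup-allTrue (f (toℕ i))
    }
    where
    inject₁-inj : ∀ i j → w (toℕ (inject₁ i)) ≡ w (toℕ (inject₁ j)) → toℕ i ≡ toℕ j
    inject₁-inj i j eq rewrite toℕ-inject₁ i | toℕ-inject₁ j = w-inj (toℕ<n i) (toℕ<n j) eq

    -- Equal edges f s = f t (s < t) force t = s + 1 and w s = w (s + 2), which is only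
    -- possible for d = 2, where it is excluded by non-backtracking.
    no-repeat : ∀ {s t} → s < t → t < d → f s ≢ f t
    no-repeat {s} {t} s<t t<d fs≡ft
      with joins-ends (subst (λ e → Joins E e (w s) (w (suc s))) fs≡ft (W (<-trans s<t t<d))) (W t<d)
    ... | inj₁ (ws≡wt , _) = <-irrefl (w-inj (<-trans s<t t<d) t<d ws≡wt) s<t
    ... | inj₂ (ws≡w2+s , w1+s≡wt) with w-inj (≤-<-trans s<t t<d) t<d w1+s≡wt
    ... | refl with m<1+n⇒m<n∨m≡n (s≤s t<d)
    ...   | inj₁ 2+s<d = <-irrefl (w-inj (<-trans s<t t<d) 2+s<d ws≡w2+s) (m<n⇒m<1+n (n<1+n s))
    ...   | inj₂ 2+s≡d with w-inj (<-trans s<t t<d) 1≤d (trans ws≡w2+s (trans (cong w 2+s≡d) wd≡w0))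
    ...     | refl = NB t<d fs≡ft

    f-inj : ∀ {s t} → s < d → t < d → f s ≡ f t → s ≡ t
    f-inj {s} {t} s<d t<d eq with <-cmp s t
    ... | tri< s<t _ _ = ⊥-elim (no-repeat s<t t<d eq)
    ... | tri≈ _ s≡t _ = s≡t
    ... | tri> _ _ t<s = ⊥-elim (no-repeat t<s s<d (sym eq))

  -- The segment between the first repeated vertex and its earlier occurrence is a cycle.
  closed-walk⇒cycle : ∀ {d w f} → 1 ≤ d → Walk d w f → NonBacktracking d f → w d ≡ w 0 →
                      ∃ λ ℓ → ℓ ≤ d × Cycle E (allTrue m) ℓ
  closed-walk⇒cycle {d} {w} {f} 1≤d W NB wd≡w0
    with least-witness (λ j → anyUpTo? (λ i → w i ≟ᶠ w j) j) d (d , ≤-refl , 0 , 1≤d , sym wd≡w0)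
  ... | j , j≤d , (i , i<j , wi≡wj) , first =
    j ∸ i , ≤-trans (m∸n≤m j i) j≤d ,
    simple-closed-walk⇒cycle (m<n⇒0<n∸m i<j)
      (Walk-drop {d = j ∸ i} i i+[j∸i]≤d W) (NonBacktracking-drop {d = j ∸ i} i i+[j∸i]≤d NB)
      (trans (cong w i+[j∸i]≡j) (trans (sym wi≡wj) (cong w (sym (+-identityʳ i)))))
      λ {s} {t} s<j∸i t<j∸i eq → +-cancelˡ-≡ i s t (w-inj (below-j s<j∸i) (below-j t<j∸i) eq)
    where
    i+[j∸i]≡j : i + (j ∸ i) ≡ j
    i+[j∸i]≡j = m+[n∸m]≡n (<⇒≤ i<j)
    i+[j∸i]≤d : i + (j ∸ i) ≤ d
    i+[j∸i]≤d = subst (_≤ d) (sym i+[j∸i]≡j) j≤d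
    below-j : ∀ {s} → s < j ∸ i → i + s < j
    below-j s<j∸i = subst (_ <_) i+[j∸i]≡j (+-monoʳ-< i s<j∸i)
    w-inj : ∀ {s t} → s < j → t < j → w s ≡ w t → s ≡ t
    w-inj {s} {t} s<j t<j eq with <-cmp s t
    ... | tri< s<t _ _ = contradiction (s , s<t , eq) (first t<j)
    ... | tri≈ _ s≡t _ = s≡t
    ... | tri> _ _ t<s = contradiction (t , t<s , sym eq) (first s<j)

  Walk-reverse : ∀ {d w f} → Walk d w f → Walk d (λ t → w (d ∸ t)) (λ t → f (d ∸ suc t))
  Walk-reverse {d} {w} {f} W {t} t<d =
    subst (λ v → Joins E (f (d ∸ suc t)) v (w (d ∸ suc t))) (cong w (sym (+-∸-assoc 1 t<d)))
          (joins-sym (W (∸-monoʳ-< z<s t<d)))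

  NonBacktracking-reverse : ∀ {d f} → NonBacktracking d f → NonBacktracking d (λ t → f (d ∸ suc t))
  NonBacktracking-reverse {d} {f} NB {t} 2+t<d eq =
    NB (subst (_< d) (+-∸-assoc 1 2+t<d) (∸-monoʳ-< z<s (<⇒≤ 2+t<d)))
       (sym (subst (λ s → f s ≡ f (d ∸ suc (suc t))) (+-∸-assoc 1 2+t<d) eq))

  Walk-append : ∀ {d e w f v g} → Walk d w f → Walk e v g → w d ≡ v 0 →
                Walk (d + e) (appendᵥ d w v) (appendₑ d f g)
  Walk-append {d} {e} {w} {f} {v} {g} W V wd≡v0 {t} t<d+e with <-or-≥ t d
  ... | inj₁ t<d =
    joins-cong (sym (appendₑ-< d t<d)) (sym (appendᵥ-≤ d (<⇒≤ t<d))) (sym (appendᵥ-≤ d t<d)) (W t<d)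
  ... | inj₂ d≤t =
    joins-cong (sym (appendₑ-≥ d d≤t)) (sym (appendᵥ-≥ d wd≡v0 d≤t))
               (sym (trans (appendᵥ-≥ d wd≡v0 (m≤n⇒m≤1+n d≤t)) (cong v (+-∸-assoc 1 d≤t))))
               (V (subst (t ∸ d <_) (m+n∸m≡n d e) (∸-monoˡ-< t<d+e d≤t)))

  NonBacktracking-append : ∀ {d e f g} → NonBacktracking d f → NonBacktracking e g →
                           (∀ {t} → suc t ≡ d → f t ≢ g 0) → NonBacktracking (d + e) (appendₑ d f g)
  NonBacktracking-append {d} {e} {f} {g} NF NG junction {t} 1+t<d+e eq with <-or-≥ t d
  ... | inj₂ d≤t =
    NG (subst (_< e) (+-∸-assoc 1 d≤t) (subst (suc t ∸ d <_) (m+n∸m≡n d e) (∸-monoˡ-< 1+t<d+e d≤1+t)))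
       (trans (sym (appendₑ-≥ d d≤t)) (trans eq (trans (appendₑ-≥ d d≤1+t) (cong g (+-∸-assoc 1 d≤t)))))
    where d≤1+t = m≤n⇒m≤1+n d≤t
  ... | inj₁ t<d with m≤n⇒m<n∨m≡n t<d
  ...   | inj₁ 1+t<d = NF 1+t<d (trans (sym (appendₑ-< d t<d)) (trans eq (appendₑ-< d 1+t<d)))
  ...   | inj₂ refl  =
    junction refl (trans (sym (appendₑ-< d t<d)) (trans eq (trans (appendₑ-≥ d ≤-refl) (cong g (n∸n≡0 d)))))

  diverging-walks⇒cycle : ∀ {k w f w′ f′} → Walk (suc k) w f → Walk (suc k) w′ f′ →
                         NonBacktracking (suc k) f → NonBacktracking (suc k) f′ →
                         w 0 ≡ w′ 0 → w (suc k) ≡ w′ (suc k) → f k ≢ f′ k →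
                         ∃ λ ℓ → ℓ ≤ suc k + suc k × Cycle E (allTrue m) ℓ
  diverging-walks⇒cycle {k} {w} {f} {w′} {f′} W W′ NB NB′ start end fk≢f′k =
    closed-walk⇒cycle (s≤s z≤n) (Walk-append W (Walk-reverse W′) end)
                     (NonBacktracking-append NB (NonBacktracking-reverse NB′) λ { refl → fk≢f′k })
                     returns
    where
    d = suc k
    returns : appendᵥ d w (λ t → w′ (d ∸ t)) (d + d) ≡ appendᵥ d w (λ t → w′ (d ∸ t)) 0
    returns = begin
      appendᵥ d w (λ t → w′ (d ∸ t)) (d + d)   ≡⟨ appendᵥ-≥ d end (m≤m+n d d) ⟩
      w′ (d ∸ (d + d ∸ d))                    ≡⟨ cong (λ s → w′ (d ∸ s)) (m+n∸m≡n d d) ⟩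
      w′ (d ∸ d)                              ≡⟨ cong w′ (n∸n≡0 d) ⟩
      w′ 0                                    ≡⟨ start ⟨
      w 0                                     ≡⟨ appendᵥ-≤ d {w} {λ t → w′ (d ∸ t)} z≤n ⟨
      appendᵥ d w (λ t → w′ (d ∸ t)) 0        ∎
      where open ≡-Reasoning

  last-divergence : ∀ {k w f w′ f′} → Walk k w f → Walk k w′ f′ → w k ≡ w′ k →
                   (∀ {t} → t < k → f t ≡ f′ t) ⊎ (∃ λ j → j < k × f j ≢ f′ j × w (suc j) ≡ w′ (suc j))
  last-divergence {zero} _ _ _ = inj₁ λ ()
  last-divergence {suc k} {w} {f} {w′} {f′} W W′ end with f k ≟ᶠ f′ k
  ... | no fk≢f′k = inj₂ (k , ≤-refl , fk≢f′k , end)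
  ... | yes fk≡f′k
    with last-divergence (Walk-≤ (n≤1+n k) W) (Walk-≤ (n≤1+n k) W′)
           (joins-other-end (joins-cong fk≡f′k refl end (W ≤-refl)) (W′ ≤-refl))
  ...   | inj₂ (j , j<k , rest) = inj₂ (j , m<n⇒m<1+n j<k , rest)
  ...   | inj₁ agree = inj₁ λ t<1+k → [ agree , (λ { refl → fk≡f′k }) ]′ (m<1+n⇒m<n∨m≡n t<1+k)

  trails-agree : ∀ {L w f w′ f′} → (∀ {ℓ} → ℓ ≤ L + L → ¬ Cycle E (allTrue m) ℓ) →
                 Trail L w f → Trail L w′ f′ → w 0 ≡ w′ 0 → w L ≡ w′ L → ∀ {t} → t < L → f t ≡ f′ t
  trails-agree {L} no-short-cycle T T′ start end with last-divergence (walk T) (walk T′) end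
  ... | inj₁ agree = agree
  ... | inj₂ (j , j<L , fj≢f′j , meet)
    with diverging-walks⇒cycle (Walk-≤ j<L (walk T)) (Walk-≤ j<L (walk T′))
           (NonBacktracking-≤ j<L (nonBacktracking T)) (NonBacktracking-≤ j<L (nonBacktracking T′))
           start meet fj≢f′j
  ...   | ℓ , ℓ≤ , cycle = contradiction cycle (no-short-cycle (≤-trans ℓ≤ (+-mono-≤ j<L j<L)))

  cycle⇒trail : ∀ {x ℓ L} → Cycle E x ℓ → L ≤ ℓ →
                Σ (ℕ → Fin n) λ w → Σ (ℕ → Fin m) λ f → Trail L w f × (∀ t → lookup x (f t) ≡ true)
  cycle⇒trail {ℓ = zero}  c _ = contradiction (pos c) λ ()
  cycle⇒trail {x} {suc ℓ} {L} c L≤1+ℓ =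
    w , f , record { walk = steps ; edges-injective = f-inj } , λ t → kept c _
    where
    w : ℕ → Fin n
    w t = vert c (t mod suc (suc ℓ))
    f : ℕ → Fin m
    f t = edge c (t mod suc ℓ)
    steps : Walk L w f
    steps {t} t<L = joins-cong refl (cong (vert c) (toℕ-injective source))
                                    (cong (vert c) (toℕ-injective target)) (joins c (t mod suc ℓ))
      where
      t<1+ℓ = <-≤-trans t<L L≤1+ℓ
      source : toℕ (inject₁ (t mod suc ℓ)) ≡ toℕ (t mod suc (suc ℓ))
      source = trans (toℕ-inject₁ _) (trans (toℕ-mod t<1+ℓ) (sym (toℕ-mod (m<n⇒m<1+n t<1+ℓ))))
      target : toℕ (Fin.suc (t mod suc ℓ)) ≡ toℕ (suc t mod suc (suc ℓ))
      target = trans (cong suc (toℕ-mod t<1+ℓ)) (sym (toℕ-mod (s≤s t<1+ℓ)))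
    f-inj : ∀ {s t} → s < L → t < L → f s ≡ f t → s ≡ t
    f-inj s<L t<L eq = trans (sym (toℕ-mod (<-≤-trans s<L L≤1+ℓ)))
                             (trans (cong toℕ (edistinct c eq)) (toℕ-mod (<-≤-trans t<L L≤1+ℓ)))

-- Edge sets and the search for trails

edgeSet : ∀ {m} → (ℕ → Fin m) → ℕ → Vec Bool m
edgeSet {m} f zero    = replicate m false
edgeSet     f (suc d) = edgeSet f d [ f d ]≔ true

edgeSet-member : ∀ {m} (f : ℕ → Fin m) d {e} → lookup (edgeSet f d) e ≡ true → ∃ λ t → t < d × f t ≡ e
edgeSet-member f zero    {e} eq = contradiction (trans (sym (lookup-replicate e false)) eq) λ ()
edgeSet-member f (suc d) {e} eq with f d ≟ᶠ e
... | yes fd≡e = d , ≤-refl , fd≡e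
... | no fd≢e with edgeSet-member f d (trans (sym (lookup∘update′ (fd≢e ∘ sym) (edgeSet f d) true)) eq)
...   | t , t<d , ft≡e = t , m<n⇒m<1+n t<d , ft≡e

card-replicate-false : ∀ m → card (replicate m false) ≡ 0
card-replicate-false zero    = refl
card-replicate-false (suc m) = card-replicate-false m

card-[]≔true : ∀ {m} (v : Vec Bool m) i → lookup v i ≡ false → card (v [ i ]≔ true) ≡ suc (card v)
card-[]≔true (false ∷ v) Fin.zero    _  = refl
card-[]≔true (true ∷ v)  (Fin.suc i) eq = cong suc (card-[]≔true v i eq)
card-[]≔true (false ∷ v) (Fin.suc i) eq = card-[]≔true v i eq

card-edgeSet : ∀ {m} (f : ℕ → Fin m) d → (∀ {s t} → s < d → t < d → f s ≡ f t → s ≡ t) →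
               card (edgeSet f d) ≡ d
card-edgeSet {m} f zero    _     = card-replicate-false m
card-edgeSet     f (suc d) f-inj =
  trans (card-[]≔true (edgeSet f d) (f d) fresh)
        (cong suc (card-edgeSet f d λ s<d t<d → f-inj (m<n⇒m<1+n s<d) (m<n⇒m<1+n t<d)))
  where
  fresh : lookup (edgeSet f d) (f d) ≡ false
  fresh with lookup (edgeSet f d) (f d) in eq
  ... | false = refl
  ... | true with edgeSet-member f d eq
  ...   | t , t<d , ft≡fd = contradiction (f-inj (m<n⇒m<1+n t<d) ≤-refl ft≡fd) (<⇒≢ t<d)

agreeOn-self : ∀ {m} (S x : Vec Bool m) → (∀ e → lookup S e ≡ true → lookup x e ≡ true) →
               agreeOn S x S ≡ true
agreeOn-self []          []      _    = refl
agreeOn-self (true ∷ S)  (b ∷ x) S⊆x with S⊆x Fin.zero refl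
... | refl = agreeOn-self S x (S⊆x ∘ Fin.suc)
agreeOn-self (false ∷ S) (b ∷ x) S⊆x = agreeOn-self S x (S⊆x ∘ Fin.suc)

∃-Vec? : ∀ {r} k {P : Vec (Fin r) k → Set} → (∀ v → Dec (P v)) → Dec (∃ P)
∃-Vec? zero    P? = map′ ([] ,_) (λ { ([] , p) → p }) (P? [])
∃-Vec? (suc k) P? = map′ (λ (x , v , p) → x ∷ v , p) (λ { (x ∷ v , p) → x , v , p })
                         (any? λ x → ∃-Vec? k (P? ∘ (x ∷_)))

module _ {n m : ℕ} (E : Graph n m) where

  open Trail

  joins? : ∀ e u v → Dec (Joins E e u v)
  joins? e u v with lookup E e
  ... | a , b = ((a ≟ᶠ u) ×-dec (b ≟ᶠ v)) ⊎-dec ((a ≟ᶠ v) ×-dec (b ≟ᶠ u))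

  trail? : ∀ d w f → Dec (Trail E d w f)
  trail? d w f with allUpTo? (λ t → joins? (f t) (w t) (w (suc t))) d
                  | allUpTo? (λ s → allUpTo? (λ t → (f s ≟ᶠ f t) →-dec (s ℕ.≟ t)) d) d
  ... | yes W | yes f-inj = yes record { walk = W ; edges-injective = λ s<d t<d → f-inj s<d t<d }
  ... | no ¬W | _         = no λ T → ¬W (walk T)
  ... | _     | no ¬f-inj = no λ T → ¬f-inj λ s<d t<d → edges-injective T s<d t<d

  Trail-cong : ∀ {d w w′ f f′} → (∀ {t} → t ≤ d → w t ≡ w′ t) → (∀ {t} → t < d → f t ≡ f′ t) →
               Trail E d w f → Trail E d w′ f′
  Trail-cong w≗w′ f≗f′ T = record
    { walk            = λ t<d → joins-cong E (f≗f′ t<d) (w≗w′ (<⇒≤ t<d)) (w≗w′ t<d) (walk T t<d)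
    ; edges-injective = λ s<d t<d eq →
                          edges-injective T s<d t<d (trans (f≗f′ s<d) (trans eq (sym (f≗f′ t<d))))
    }

  module _ (L : ℕ) where

    _‼_ : ∀ {A : Set} → Vec A (suc L) → ℕ → A
    v ‼ t = lookup v (t mod suc L)

    TrailBetween : Fin n → Fin n → Set
    TrailBetween a b = Σ (Vec (Fin n) (suc L)) λ ws → Σ (Vec (Fin m) (suc L)) λ fs →
                       Trail E L (ws ‼_) (fs ‼_) × ws ‼ 0 ≡ a × ws ‼ L ≡ b

    trailBetween? : ∀ a b → Dec (TrailBetween a b)
    trailBetween? a b = ∃-Vec? (suc L) λ ws → ∃-Vec? (suc L) λ fs →
                        trail? L (ws ‼_) (fs ‼_) ×-dec (ws ‼ 0 ≟ᶠ a) ×-dec (ws ‼ L ≟ᶠ b)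

    trail⇒trailBetween : ∀ {w f} → Trail E L w f → TrailBetween (w 0) (w L)
    trail⇒trailBetween {w} {f} T =
      tabulate (w ∘ toℕ) , tabulate (f ∘ toℕ) ,
      Trail-cong (sym ∘ tabulated w) (sym ∘ tabulated f ∘ <⇒≤) T , tabulated w z≤n , tabulated w ≤-refl
      where
      tabulated : ∀ {A : Set} (g : ℕ → A) {t} → t ≤ L → tabulate (g ∘ toℕ) ‼ t ≡ g t
      tabulated g t≤L = trans (lookup∘tabulate (g ∘ toℕ) _) (cong g (toℕ-mod (s≤s t≤L)))

-- The trail length

n<2^n : ∀ n → n < 2 ^ n
n<2^n zero    = s≤s z≤n
n<2^n (suc n) = begin-strict
  suc n            <⟨ +-mono-≤ (m^n>0 2 n) (n<2^n n) ⟩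
  2 ^ n + 2 ^ n    ≡⟨ cong (2 ^ n +_) (+-identityʳ (2 ^ n)) ⟨
  2 ^ suc n        ∎
  where open ≤-Reasoning

pow2-bracket : ∀ N → 1 ≤ N → ∃ λ k → N ≤ 2 ^ k × 2 ^ k < 2 * N
pow2-bracket N 1≤N = descend N (<⇒≤ (n<2^n N))
  where
  descend : ∀ j → N ≤ 2 ^ j → ∃ λ k → N ≤ 2 ^ k × 2 ^ k < 2 * N
  descend zero    N≤1 = 0 , N≤1 , *-monoʳ-≤ 2 1≤N
  descend (suc j) N≤2^1+j with N ≤? 2 ^ j
  ... | yes N≤2^j = descend j N≤2^j
  ... | no  N≰2^j = suc j , N≤2^1+j , *-monoʳ-< 2 (≰⇒> N≰2^j)

module TrailLength (m : ℕ) (256≤m : 256 ≤ m) where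

  1≤m : 1 ≤ m
  1≤m = ≤-trans (s≤s z≤n) 256≤m

  instance
    m≢0 : NonZero m
    m≢0 = ℕ.>-nonZero 1≤m

  -- The number of endpoint pairs, (2m)², times the target 1/m of the failure probability.
  Q : ℕ
  Q = (m + m) * (m + m) * m

  4Q≡16m³ : 4 * Q ≡ 16 * m ^ 3
  4Q≡16m³ = expand m
    where
    expand : ∀ x → 4 * ((x + x) * (x + x) * x) ≡ 16 * (x * (x * (x * 1)))
    expand = solve-∀

  4Q≤m^4 : 4 * Q ≤ m ^ 4
  4Q≤m^4 = subst (_≤ m ^ 4) (sym 4Q≡16m³) (*-monoˡ-≤ (m ^ 3) (≤-trans (m≤n+m 16 240) 256≤m))

  [4Q]²≤m^7 : 4 * Q * (4 * Q) ≤ m ^ 7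
  [4Q]²≤m^7 = begin
    4 * Q * (4 * Q)            ≡⟨ cong₂ _*_ 4Q≡16m³ 4Q≡16m³ ⟩
    16 * m ^ 3 * (16 * m ^ 3)  ≡⟨ square (m ^ 3) ⟩
    256 * (m ^ 3 * m ^ 3)      ≤⟨ *-monoˡ-≤ (m ^ 3 * m ^ 3) 256≤m ⟩
    m * (m ^ 3 * m ^ 3)        ≡⟨ cong (m *_) (^-distribˡ-+-* m 3 3) ⟨
    m ^ 7                      ∎
    where
    open ≤-Reasoning
    square : ∀ c → 16 * c * (16 * c) ≡ 256 * (c * c)
    square = solve-∀

  1≤Q : 1 ≤ Q
  1≤Q = *-mono-≤ (*-mono-≤ 1≤m+m 1≤m+m) 1≤m
    where 1≤m+m = ≤-trans 1≤m (m≤m+n m m)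

  private
    bracket = pow2-bracket (2 * Q) (≤-trans 1≤Q (m≤n*m Q 2))

  L : ℕ
  L = proj₁ bracket

  2Q≤2^L : 2 * Q ≤ 2 ^ L
  2Q≤2^L = proj₁ (proj₂ bracket)

  2^L<4Q : 2 ^ L < 4 * Q
  2^L<4Q = subst (2 ^ L <_) (sym (*-assoc 2 2 Q)) (proj₂ (proj₂ bracket))

  1≤L : 1 ≤ L
  1≤L = n≢0⇒n>0 λ L≡0 → contradiction (subst (λ k → 2 * Q ≤ 2 ^ k) L≡0 2Q≤2^L) (<⇒≱ (*-monoʳ-≤ 2 1≤Q))

  2^L≤m^14 : 2 ^ (L * 1) ≤ m ^ (2 * 7)
  2^L≤m^14 = subst (λ k → 2 ^ k ≤ m ^ 14) (sym (*-identityʳ L))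
                   (≤-trans (<⇒≤ 2^L<4Q) (≤-trans 4Q≤m^4 (^-monoʳ-≤ m (m≤m+n 4 10))))

  4Q≤m^200 : 4 * Q ≤ m ^ 200
  4Q≤m^200 = ≤-trans 4Q≤m^4 (^-monoʳ-≤ m (m≤m+n 4 196))

  2^[L+L]<m^7 : 2 ^ (L + L) < m ^ 7
  2^[L+L]<m^7 = begin-strict
    2 ^ (L + L)       ≡⟨ ^-distribˡ-+-* 2 L L ⟩
    2 ^ L * 2 ^ L     <⟨ *-mono-< 2^L<4Q 2^L<4Q ⟩
    4 * Q * (4 * Q)   ≤⟨ [4Q]²≤m^7 ⟩
    m ^ 7             ∎
    where open ≤-Reasoning

-- Surviving cycles

length-cartesianProduct : ∀ {A B : Set} (xs : List A) (ys : List B) →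
                          length (cartesianProduct xs ys) ≡ length xs * length ys
length-cartesianProduct []       ys = refl
length-cartesianProduct (x ∷ xs) ys =
  trans (length-++ (map (x ,_) ys)) (cong₂ _+_ (length-map (x ,_) ys) (length-cartesianProduct xs ys))

module Subsampling (m : ℕ) (256≤m : 256 ≤ m) {n : ℕ} (E : Graph n m)
            (girth : ∀ ℓ → Cycle E (allTrue m) ℓ → m ^ 7 ≤ 2 ^ (ℓ * 1))
            (D : Distribution m)
            (indep : AlmostIndependent D (λ s → 2 ^ (s * 1) ≤ m ^ (2 * 7))
                                         (λ t → t *ℚ ℕ→ℚ (m ^ 200) ≤ℚ 1ℚ)) where

  open TrailLength m 256≤m
  open Trail

  no-short-cycle : ∀ {ℓ} → ℓ ≤ L + L → ¬ Cycle E (allTrue m) ℓ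
  no-short-cycle {ℓ} ℓ≤2L c =
    contradiction (≤-trans (girth ℓ c) (^-monoʳ-≤ 2 (subst (_≤ L + L) (sym (*-identityʳ ℓ)) ℓ≤2L)))
                  (<⇒≱ 2^[L+L]<m^7)

  endpoints : List (Fin n)
  endpoints = map (proj₁ ∘ lookup E) (allFin m) ++ map (proj₂ ∘ lookup E) (allFin m)

  joins⇒endpoint : ∀ {e u v} → Joins E e u v → u ∈ endpoints
  joins⇒endpoint {e} (inj₁ (refl , _)) = ∈-++⁺ˡ (∈-map⁺ (proj₁ ∘ lookup E) (∈-allFin e))
  joins⇒endpoint {e} (inj₂ (_ , refl)) = ∈-++⁺ʳ _ (∈-map⁺ (proj₂ ∘ lookup E) (∈-allFin e))

  length-endpoints : length endpoints ≡ m + m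
  length-endpoints = trans (length-++ (map (proj₁ ∘ lookup E) (allFin m)))
                           (cong₂ _+_ (trans (length-map _ (allFin m)) (length-tabulate {n = m} id))
                                      (trans (length-map _ (allFin m)) (length-tabulate {n = m} id)))

  endpointPairs : List (Fin n × Fin n)
  endpointPairs = cartesianProduct endpoints endpoints

  #pairs*m≡Q : length endpointPairs * m ≡ Q
  #pairs*m≡Q = cong (_* m) (trans (length-cartesianProduct endpoints endpoints)
                                  (cong₂ _*_ length-endpoints length-endpoints))

  trailKept : ∀ {a b} → Dec (TrailBetween E L a b) → Vec Bool m → Bool
  trailKept (yes (_ , fs , _)) x = agreeOn S x S
    where S = edgeSet (_‼_ E L fs) L
  trailKept (no _)             _ = false

  trailKeptBetween : Fin n × Fin n → Vec Bool m → Bool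
  trailKeptBetween (a , b) = trailKept (trailBetween? E L a b)

  someTrailKept : Vec Bool m → Bool
  someTrailKept x = any (λ k → trailKeptBetween k x) endpointPairs

  cycle-length≥L : ∀ {x ℓ} → Cycle E x ℓ → L ≤ ℓ
  cycle-length≥L c = ≮⇒≥ λ ℓ<L → no-short-cycle (≤-trans (<⇒≤ ℓ<L) (m≤m+n L L)) (Cycle-allTrue E c)

  walk-end : ∀ {d w f} → 1 ≤ d → Walk E d w f → w d ∈ endpoints
  walk-end {suc d} _ W = joins⇒endpoint (joins-sym E (W ≤-refl))

  kept-trail⇒someTrailKept : ∀ {x w f} → Trail E L w f → (∀ t → lookup x (f t) ≡ true) →
                             T (someTrailKept x)
  kept-trail⇒someTrailKept {x} {w} {f} T-wf kept-f =
    any⁺ (λ k → trailKeptBetween k x)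
         (lose {P = λ k → T (trailKeptBetween k x)}
               (∈-cartesianProduct⁺ (joins⇒endpoint (walk T-wf 1≤L)) (walk-end 1≤L (walk T-wf)))
               (kept-along (trailBetween? E L (w 0) (w L))))
    where
    kept-along : (found : Dec (TrailBetween E L (w 0) (w L))) → T (trailKept found x)
    kept-along (no ∄) = ∄ (trail⇒trailBetween E L T-wf)
    kept-along (yes (ws , fs , T-found , start , end)) = subst T (sym (agreeOn-self S x S⊆x)) _
      where
      S = edgeSet (_‼_ E L fs) L
      S⊆x : ∀ e → lookup S e ≡ true → lookup x e ≡ true
      S⊆x e e∈S with edgeSet-member (_‼_ E L fs) L e∈S
      ... | t , t<L , refl =
        trans (cong (lookup x) (trails-agree E no-short-cycle T-found T-wf start end t<L)) (kept-f t)

  cycle⇒someTrailKept : ∀ {x ℓ} → Cycle E x ℓ → T (someTrailKept x)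
  cycle⇒someTrailKept c = let _ , _ , T-wf , kept-f = cycle⇒trail E c (cycle-length≥L c)
                          in kept-trail⇒someTrailKept T-wf kept-f

  trailKeptBetween-bound : ∀ k → Pr D (trailKeptBetween k) *ℚ ℕ→ℚ Q ≤ℚ 1ℚ
  trailKeptBetween-bound (a , b) = bound (trailBetween? E L a b)
    where
    bound : (found : Dec (TrailBetween E L a b)) → Pr D (trailKept found) *ℚ ℕ→ℚ Q ≤ℚ 1ℚ
    bound (no _) = subst (_≤ℚ 1ℚ) (sym (trans (cong (_*ℚ ℕ→ℚ Q) (Pr-false D)) (ℚ.*-zeroˡ (ℕ→ℚ Q))))
                         (ℚ.nonNegative⁻¹ 1ℚ)
    bound (yes (_ , fs , T-found , _)) =
      X≤½^k+2t⇒X*Q≤1 {k = L} {Q = Q} {P = m ^ 200}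
        (tvMarginalUniform-nonNeg D S) Pr≤ 2Q≤2^L 4Q≤m^200
        (indep S (subst (λ s → 2 ^ (s * 1) ≤ m ^ (2 * 7)) (sym |S|≡L) 2^L≤m^14))
      where
      S = edgeSet (_‼_ E L fs) L
      |S|≡L : card S ≡ L
      |S|≡L = card-edgeSet (_‼_ E L fs) L (edges-injective T-found)
      Pr≤ : Pr D (λ x → agreeOn S x S) ≤ℚ ½ ^ℚ L +ℚ ℕ→ℚ 2 *ℚ tvMarginalUniform D S
      Pr≤ = subst (λ k → Pr D (λ x → agreeOn S x S) ≤ℚ ½ ^ℚ k +ℚ ℕ→ℚ 2 *ℚ tvMarginalUniform D S)
                  |S|≡L (Pr-agreeOn-self≤ D S)

  good : Vec Bool m → Bool
  good x = not (someTrailKept x)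

  good⇒cycleFree : ∀ x → T (good x) → CycleFree E x
  good⇒cycleFree x good-x ℓ c = subst T (Equivalence.to T-not-≡ good-x) (cycle⇒someTrailKept c)

  1-Pr[good]≤1/m : ((1ℚ - Pr D good) ^ℚ 1) *ℚ ℕ→ℚ (m ^ 1) ≤ℚ 1ℚ
  1-Pr[good]≤1/m = subst₂ (λ p k → p *ℚ ℕ→ℚ k ≤ℚ 1ℚ)
                        (trans (sym (Pr-not D someTrailKept)) (sym (ℚ.*-identityʳ _))) (sym (*-identityʳ m))
                        (union-bound D trailKeptBetween endpointPairs m 1≤#pairs λ k →
                           subst (λ q → Pr D (trailKeptBetween k) *ℚ ℕ→ℚ q ≤ℚ 1ℚ) (sym #pairs*m≡Q)
                                 (trailKeptBetween-bound k))
    where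
    1≤#pairs : 1 ≤ length endpointPairs
    1≤#pairs = n≢0⇒n>0 λ #pairs≡0 →
      contradiction (subst (1 ≤_) (trans (sym #pairs*m≡Q) (cong (_* m) #pairs≡0)) 1≤Q) λ ()

theorem1p2 :
  -- κ = p / q > 0 and c = c₁ / c₂ > 0 (absolute constants), threshold M for "m large"
  Σ ℕ λ p → Σ ℕ λ q → 1 ≤ p × 1 ≤ q ×
  Σ ℕ λ c₁ → Σ ℕ λ c₂ → 1 ≤ c₁ × 1 ≤ c₂ ×
  Σ ℕ λ M →
  ∀ (m : ℕ) → M ≤ m →
  ∀ (n : ℕ) (E : Graph n m) →
  -- every cycle of G has length ℓ ≥ κ log m, i.e. m^p ≤ 2^(ℓ q)
  (∀ ℓ → Cycle E (allTrue m) ℓ → m ^ p ≤ 2 ^ (ℓ * q)) →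
  ∀ (D : Distribution m) →
  -- (1/m^200)-almost (2κ log m)-wise independent with marginals 1/2:
  -- |S| ≤ 2 κ log m  iff  2^(|S| q) ≤ m^(2p);  TV ≤ 1/m^200  iff  TV * m^200 ≤ 1
  AlmostIndependent D (λ s → 2 ^ (s * q) ≤ m ^ (2 * p))
                      (λ t → t *ℚ ℕ→ℚ (m ^ 200) ≤ℚ 1ℚ) →
  -- Pr[subsample cycle-free] ≥ 1 - m^(-c₁/c₂)
  Σ (Vec Bool m → Bool) λ A →
    (∀ x → T (A x) → CycleFree E x) ×
    (((1ℚ - Pr D A) ^ℚ c₂) *ℚ ℕ→ℚ (m ^ c₁) ≤ℚ 1ℚ)
theorem1p2 = 7 , 1 , s≤s z≤n , s≤s z≤n , 1 , 1 , s≤s z≤n , s≤s z≤n , 256 ,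
  λ m 256≤m n E girth D indep →
    let open Subsampling m 256≤m E girth D indep in good , good⇒cycleFree , 1-Pr[good]≤1/m
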